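{- Let $f,g,h$ be integers with $2<f=g<h$. Then $n(f,g,h)=2h-f+1$.
   Context: All graphs are finite, simple and undirected. A complete $k$-coloring of a graph $G=(V,E)$ is a map $\varphi:V\to\{1,\dots,k\}$, using all $k$ colors, such that adjacent vertices get different colors and for any two colors $i\neq j$ there is an edge between the color classes $i$ and $j$. The chromatic number $\chi(G)$ is the minimum number of colors in a proper coloring; the achromatic number $\psi(G)$ is the maximum $k$ for which $G$ has a complete $k$-coloring. A Grundy coloring is a proper coloring $\varphi:V\to\{1,\dots,k\}$ such that every vertex $v$ has a neighbor of color $i$ for every $1\le i<\varphi(v)$; the Grundy number $\Gamma(G)$ is the largest $k$ for which $G$ has a Grundy coloring with $k$ colors. For integers $2\le f\le g\le h$ such that a connected graph $G$ with $\chi(G)=f$, $\Gamma(G)=g$, $\psi(G)=h$ exists, $n(f,g,h)$ denotes the minimum number of vertices of such a connected graph. -}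

module Defs where

open import Data.Nat using (ℕ; _≤_; _<_)
open import Data.Fin using (Fin; toℕ)
open import Data.Bool using (Bool; true; false)
open import Data.Product using (Σ; ∃; ∃-syntax; _×_; _,_)
open import Relation.Binary.PropositionalEquality using (_≡_; _≢_)
open import Relation.Nullary using (¬_)
open import Function.Definitions using (Surjective)

record Graph (n : ℕ) : Set where
  field
    adj   : Fin n → Fin n → Bool
    sym   : ∀ u v → adj u v ≡ adj v u
    irrefl : ∀ u → adj u u ≡ false

module _ {n : ℕ} (G : Graph n) where
  open Graph G

  E : Fin n → Fin n → Set
  E u v = adj u v ≡ true

  data Reachable : Fin n → Fin n → Set where
    here : ∀ {u} → Reachable u u
    step : ∀ {u w v} → E u w → Reachable w v → Reachable u v

  Connected : Set
  Connected = ∀ u v → Reachable u v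

  -- colors {1,…,k} are represented by Fin k (color i+1 ↦ i)
  Proper : {k : ℕ} → (Fin n → Fin k) → Set
  Proper φ = ∀ u v → E u v → φ u ≢ φ v

  UsesAll : {k : ℕ} → (Fin n → Fin k) → Set
  UsesAll {k} φ = Surjective _≡_ _≡_ φ

  Complete : {k : ℕ} → (Fin n → Fin k) → Set
  Complete {k} φ = Proper φ × UsesAll φ ×
    (∀ (i j : Fin k) → i ≢ j → ∃[ u ] ∃[ v ] (E u v × φ u ≡ i × φ v ≡ j))

  Grundy : {k : ℕ} → (Fin n → Fin k) → Set
  Grundy {k} φ = Proper φ × UsesAll φ ×
    (∀ v (i : Fin k) → toℕ i < toℕ (φ v) → ∃[ u ] (E v u × φ u ≡ i))

  ChromaticNumber : ℕ → Set
  ChromaticNumber f = (Σ (Fin n → Fin f) Proper) ×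
    (∀ k → k < f → ¬ Σ (Fin n → Fin k) Proper)

  GrundyNumber : ℕ → Set
  GrundyNumber g = (Σ (Fin n → Fin g) Grundy) ×
    (∀ k → Σ (Fin n → Fin k) Grundy → k ≤ g)

  AchromaticNumber : ℕ → Set
  AchromaticNumber h = (Σ (Fin n → Fin h) Complete) ×
    (∀ k → Σ (Fin n → Fin k) Complete → k ≤ h)

Realizes : ∀ {n} → Graph n → ℕ → ℕ → ℕ → Set
Realizes G f g h = Connected G × ChromaticNumber G f × GrundyNumber G g × AchromaticNumber G h

IsMinOrder : ℕ → ℕ → ℕ → ℕ → Set
IsMinOrder f g h m = (Σ (Graph m) λ G → Realizes G f g h) ×
  (∀ n (G : Graph n) → Realizes G f g h → m ≤ n)

module Submission where

-- Lower bound, valid for every graph: if Γ(G) ≤ f and G has a complete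
-- k-colouring with k > f, then fewer than f colour classes are singletons
-- (otherwise giving f singleton classes the colours 1, …, f above a further
-- class coloured 0 is a partial Grundy colouring whose greedy extension has
-- f + 1 colours), and every other class has two vertices; hence G has at
-- least 2k - f + 1 vertices.
-- Upper bound: for f = m + 3 and h = f + t, the join G_{m,t} = K_m ∨ H_t of
-- a clique with a "half graph" H_t on 2t + 4 vertices is connected, has
-- χ = Γ = m + 3 and a complete (m + t + 3)-colouring; Γ ≤ m + 3 because H_t
-- carries no four layers of a Grundy colouring. The lower bound, applied to
-- G_{m,t} itself, also shows ψ(G_{m,t}) = h.

open import Defs
open import Data.Nat using (ℕ; suc; z≤n; s≤s; _<_; _+_; _*_; _∸_)
open import Data.Nat.Properties using (+-suc; m≤n⇒∃[o]m+o≡n)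
open import Data.Product using (_,_)
open import Relation.Binary.PropositionalEquality using (_≡_; refl; sym; trans; subst)

module Counting where
  open import Data.Nat using (ℕ; zero; suc; _+_; _≤_; _<_; z≤n; s≤s)
  open import Data.Nat.Properties using (+-suc; <-cmp; <⇒≢; <⇒≱)
  open import Data.Fin using (Fin; zero; suc; toℕ; join; splitAt)
  open import Data.Fin.Properties
    using (injective⇒≤; toℕ-injective; splitAt-join; join-splitAt; any?; all?; ¬∀⟶∃¬; _≟_)
  open import Data.Sum using (_⊎_; inj₁; inj₂)
  open import Data.Product using (∃; _,_; proj₁; proj₂)
  open import Data.Empty using (⊥-elim)
  open import Relation.Nullary using (¬_; Dec; yes; no; ¬?)
  open import Relation.Binary.PropositionalEquality using (_≡_; _≢_; refl; sym; trans; cong)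
  open import Relation.Binary.Definitions using (tri<; tri≈; tri>)

  record Enum (k : ℕ) (P : Fin k → Set) : Set where
    field
      cnt       : ℕ
      enum      : Fin cnt → Fin k
      enumP     : ∀ i → P (enum i)
      idx       : ∀ c → P c → Fin cnt
      enum-idx  : ∀ c p → enum (idx c p) ≡ c
      enum-mono : ∀ {i j} → toℕ i < toℕ j → toℕ (enum i) < toℕ (enum j)

    enum-inj : ∀ {i j} → enum i ≡ enum j → i ≡ j
    enum-inj {i} {j} e with <-cmp (toℕ i) (toℕ j)
    ... | tri< i<j _ _ = ⊥-elim (<⇒≢ (enum-mono i<j) (cong toℕ e))
    ... | tri≈ _ i≡j _ = toℕ-injective i≡j
    ... | tri> _ _ j<i = ⊥-elim (<⇒≢ (enum-mono j<i) (cong toℕ (sym e)))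

  open Enum

  enumerate : ∀ {k} (P : Fin k → Set) → (∀ c → Dec (P c)) → Enum k P
  enumerate {zero} P P? = record
    { cnt = 0 ; enum = λ () ; enumP = λ () ; idx = λ () ; enum-idx = λ () ; enum-mono = λ {} }
  enumerate {suc k} P P? with P? zero | enumerate (λ c → P (suc c)) (λ c → P? (suc c))
  ... | yes p0 | E = record
    { cnt = suc (cnt E) ; enum = en ; enumP = enP ; idx = ix ; enum-idx = en-ix ; enum-mono = en-mono }
    where
    en : Fin (suc (cnt E)) → Fin (suc k)
    en zero    = zero
    en (suc i) = suc (enum E i)
    enP : ∀ i → P (en i)
    enP zero    = p0
    enP (suc i) = enumP E i
    ix : ∀ c → P c → Fin (suc (cnt E))
    ix zero    _ = zero
    ix (suc c) p = suc (idx E c p)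
    en-ix : ∀ c p → en (ix c p) ≡ c
    en-ix zero    _ = refl
    en-ix (suc c) p = cong suc (enum-idx E c p)
    en-mono : ∀ {i j} → toℕ i < toℕ j → toℕ (en i) < toℕ (en j)
    en-mono {zero}  {suc j} _         = s≤s z≤n
    en-mono {suc i} {suc j} (s≤s i<j) = s≤s (enum-mono E i<j)
  ... | no ¬p0 | E = record
    { cnt = cnt E ; enum = λ i → suc (enum E i) ; enumP = enumP E ; idx = ix ; enum-idx = en-ix
    ; enum-mono = λ i<j → s≤s (enum-mono E i<j) }
    where
    ix : ∀ c → P c → Fin (cnt E)
    ix zero    p = ⊥-elim (¬p0 p)
    ix (suc c) p = idx E c p
    en-ix : ∀ c p → suc (enum E (ix c p)) ≡ c
    en-ix zero    p = ⊥-elim (¬p0 p)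
    en-ix (suc c) p = cong suc (enum-idx E c p)

  count-split : ∀ {k} (P : Fin k → Set) (P? : ∀ c → Dec (P c)) →
    cnt (enumerate P P?) + cnt (enumerate (λ c → ¬ P c) (λ c → ¬? (P? c))) ≡ k
  count-split {zero}  P P? = refl
  count-split {suc k} P P? with P? zero | count-split (λ c → P (suc c)) (λ c → P? (suc c))
  ... | yes _ | ih = cong suc ih
  ... | no _  | ih = trans (+-suc _ _) (cong suc ih)

  injective-into-⊎ : ∀ {k m c} (g : Fin k → Fin m ⊎ Fin c) →
    (∀ {i j} → g i ≡ g j → i ≡ j) → k ≤ m + c
  injective-into-⊎ {m = m} {c} g g-inj = injective⇒≤ {f = λ i → join m c (g i)} λ {i} {j} e →
    g-inj (trans (sym (splitAt-join m c (g i))) (trans (cong (splitAt m) e) (splitAt-join m c (g j))))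

  injective-from-⊎ : ∀ {m c n} (g : Fin m ⊎ Fin c → Fin n) →
    (∀ {x y} → g x ≡ g y → x ≡ y) → m + c ≤ n
  injective-from-⊎ {m} {c} g g-inj = injective⇒≤ {f = λ i → g (splitAt m i)} λ {i} {j} e →
    trans (sym (join-splitAt m c i)) (trans (cong (join m c) (g-inj e)) (join-splitAt m c j))

  -- A map Fin f → Fin k with f < k misses some value (else choosing
  -- preimages would inject Fin k into Fin f).
  missed-value : ∀ {f k} (σ : Fin f → Fin k) → f < k → ∃ λ d → ∀ i → σ i ≢ d
  missed-value {f} {k} σ f<k with ¬∀⟶∃¬ k _ (λ d → any? (λ i → σ i ≟ d)) not-onto
    where
    not-onto : ¬ (∀ d → ∃ λ i → σ i ≡ d)
    not-onto hit = <⇒≱ f<k (injective⇒≤ {f = λ d → proj₁ (hit d)} λ {d} {d'} e →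
      trans (sym (proj₂ (hit d))) (trans (cong σ e) (proj₂ (hit d'))))
  ... | d , missed = d , λ i e → missed (i , e)

  Missed : ∀ {m k} → (Fin m → Fin k) → Fin k → Set
  Missed κ c = ∀ a → κ a ≢ c

  missed-enum : ∀ {m k} (κ : Fin m → Fin k) → Enum k (Missed κ)
  missed-enum κ = enumerate (Missed κ) (λ c → all? (λ a → ¬? (κ a ≟ c)))

  count-outside-image : ∀ {m k} (κ : Fin m → Fin k) → k ≤ m + cnt (missed-enum κ)
  count-outside-image {m} {k} κ = injective-into-⊎ code λ {c} {c'} e →
    trans (sym (decode-code c)) (trans (cong decode e) (decode-code c'))
    where
    M : Enum k (Missed κ)
    M = missed-enum κ
    code : Fin k → Fin m ⊎ Fin (cnt M)
    code c with any? (λ a → κ a ≟ c)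
    ... | yes (a , _) = inj₁ a
    ... | no none     = inj₂ (idx M c (λ a e → none (a , e)))
    decode : Fin m ⊎ Fin (cnt M) → Fin k
    decode (inj₁ a) = κ a
    decode (inj₂ j) = enum M j
    decode-code : ∀ c → decode (code c) ≡ c
    decode-code c with any? (λ a → κ a ≟ c)
    ... | yes (_ , κa≡c) = κa≡c
    ... | no none        = enum-idx M c _

module GraphFacts where
  open import Data.Nat using (ℕ; _≤_)
  open import Data.Fin using (Fin)
  open import Data.Fin.Properties using (injective⇒≤; _≟_)
  open import Data.Product using (_,_)
  open import Data.Empty using (⊥-elim)
  open import Relation.Nullary using (yes; no)
  open import Relation.Binary.PropositionalEquality using (_≡_; _≢_; sym; trans)

  module _ {n : ℕ} (G : Graph n) where

    E-sym : ∀ {u v} → E G u v → E G v u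
    E-sym {u} {v} e = trans (Graph.sym G v u) e

    reach-trans : ∀ {u w v} → Reachable G u w → Reachable G w v → Reachable G u v
    reach-trans here       r' = r'
    reach-trans (step e r) r' = step e (reach-trans r r')

    reach-sym : ∀ {u v} → Reachable G u v → Reachable G v u
    reach-sym here       = here
    reach-sym (step e r) = reach-trans (reach-sym r) (step (E-sym e) here)

    connected-via-hub : (hub : Fin n) → (∀ u → Reachable G u hub) → Connected G
    connected-via-hub hub to-hub u v = reach-trans (to-hub u) (reach-sym (to-hub v))

    clique-bound : ∀ {f k} (cl : Fin f → Fin n) → (∀ i j → i ≢ j → E G (cl i) (cl j)) →
      (ψ : Fin n → Fin k) → Proper G ψ → f ≤ k
    clique-bound cl clique ψ ψ-proper = injective⇒≤ {f = λ i → ψ (cl i)} distinct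
      where
      distinct : ∀ {i j} → ψ (cl i) ≡ ψ (cl j) → i ≡ j
      distinct {i} {j} e with i ≟ j
      ... | yes i≡j = i≡j
      ... | no i≢j  = ⊥-elim (ψ-proper (cl i) (cl j) (clique i j i≢j) e)

module Greedy where
  open GraphFacts using (E-sym)
  open import Data.Nat using (ℕ; zero; suc; _+_; _∸_; _≤_; _<_; z≤n; s≤s; s≤s⁻¹; _≟_; _≤?_; _<?_)
  open import Data.Nat.Properties
  open import Data.Fin using (Fin; zero; suc; toℕ; fromℕ<)
  open import Data.Fin.Properties
    using (injective⇒≤; toℕ-injective; toℕ-fromℕ<; toℕ<n; toℕ-inject; ¬∀⟶∃¬-smallest; any?)
  open import Data.Bool using (true; false)
  open import Data.Bool.Properties using () renaming (_≟_ to _≟ᴮ_)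
  open import Data.Sum using (_⊎_; inj₁; inj₂)
  open import Data.Product using (Σ; ∃-syntax; _×_; _,_; proj₁; proj₂)
  open import Data.Empty using (⊥-elim)
  open import Relation.Nullary using (¬_; Dec; yes; no)
  open import Relation.Nullary.Decidable using (_×-dec_; _⊎-dec_)
  open import Relation.Binary.PropositionalEquality using (_≡_; _≢_; refl; sym; trans; cong; subst)
  open import Relation.Binary.Definitions using (tri<; tri≈; tri>)

  -- It exists because Q has at most n elements, so some j ≤ n is missed.
  mex : ∀ {n} (Q : Fin n → Set) → (∀ u → Dec (Q u)) → (val : Fin n → ℕ) →
    Σ ℕ λ m → (∀ u → Q u → val u ≢ m) × (∀ j → j < m → ∃[ u ] (Q u × val u ≡ j))
  mex {n} Q Q? val with ¬∀⟶∃¬-smallest (suc n) Attained Attained? not-all-attained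
    where
    Attained : Fin (suc n) → Set
    Attained j = ∃[ u ] (Q u × val u ≡ toℕ j)
    Attained? : ∀ j → Dec (Attained j)
    Attained? j = any? (λ u → Q? u ×-dec (val u ≟ toℕ j))
    not-all-attained : ¬ (∀ j → Attained j)
    not-all-attained att = 1+n≰n (injective⇒≤ {f = λ j → proj₁ (att j)} λ {i} {j} e →
      toℕ-injective (trans (sym (proj₂ (proj₂ (att i)))) (trans (cong val e) (proj₂ (proj₂ (att j))))))
  ... | i , i-missed , below = toℕ i , (λ u q e → i-missed (u , q , e)) , below-attained
    where
    below-attained : ∀ j → j < toℕ i → ∃[ u ] (Q u × val u ≡ j)
    below-attained j j<i with below (fromℕ< j<i)
    ... | u , q , e = u , q , trans e (trans (toℕ-inject (fromℕ< j<i)) (toℕ-fromℕ< j<i))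

  argmax : ∀ {n} (f : Fin n → ℕ) → Fin n → Σ (Fin n) λ w → ∀ v → f v ≤ f w
  argmax {suc zero} f _ = zero , λ { zero → ≤-refl }
  argmax {suc (suc n)} f _ with argmax (λ v → f (suc v)) zero
  ... | w , w-max with f zero ≤? f (suc w)
  ... | yes le = suc w , λ { zero → le ; (suc v) → w-max v }
  ... | no nle = zero , λ { zero → ≤-refl ; (suc v) → ≤-trans (w-max v) (<⇒≤ (≰⇒> nle)) }

  -- Colouring the remaining vertices in
  -- index order, each with the least colour missing among its already
  -- coloured neighbours, yields a Grundy colouring of G extending c0.
  module GreedyExtension {n : ℕ} (G : Graph n) (S : Fin n → Set) (S? : ∀ v → Dec (S v))
    (c0 : Fin n → ℕ)
    (seed-proper : ∀ u v → S u → S v → E G u v → c0 u ≢ c0 v)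
    (seed-grundy : ∀ v → S v → ∀ j → j < c0 v → ∃[ u ] (S u × E G v u × c0 u ≡ j)) where

    E? : ∀ u v → Dec (E G u v)
    E? u v = Graph.adj G u v ≟ᴮ true

    -- after i steps, the vertices of S and those of index < i are coloured
    Coloured : ℕ → Fin n → Set
    Coloured i u = S u ⊎ toℕ u < i

    Earlier : ℕ → Fin n → Fin n → Set
    Earlier i v u = E G v u × Coloured i u

    Earlier? : ∀ i v u → Dec (Earlier i v u)
    Earlier? i v u = E? v u ×-dec (S? u ⊎-dec (toℕ u <? i))

    stage : ℕ → Fin n → ℕ
    stage zero v = c0 v
    stage (suc i) v with S? v | toℕ v ≟ i
    ... | no _ | yes _ = proj₁ (mex (Earlier i v) (Earlier? i v) (stage i))
    ... | _    | _     = stage i v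

    stage-step : ∀ i j u → Coloured i u → i ≤ j → stage (suc j) u ≡ stage j u
    stage-step i j u col i≤j with S? u | toℕ u ≟ j
    ... | yes _  | _     = refl
    ... | no _   | no _  = refl
    ... | no u∉S | yes e with col
    ...   | inj₁ u∈S = ⊥-elim (u∉S u∈S)
    ...   | inj₂ u<i = ⊥-elim (<⇒≢ (<-≤-trans u<i i≤j) e)

    stage-stable : ∀ i j u → Coloured i u → i ≤ j → stage j u ≡ stage i u
    stage-stable i j u col i≤j =
      trans (cong (λ x → stage x u) (sym (m∸n+n≡m i≤j))) (after (j ∸ i))
      where
      after : ∀ d → stage (d + i) u ≡ stage i u
      after zero    = refl
      after (suc d) = trans (stage-step i (d + i) u col (m≤n+m i d)) (after d)

    c : Fin n → ℕ
    c = stage n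

    c-seed : ∀ v → S v → c v ≡ c0 v
    c-seed v v∈S = stage-stable 0 n v (inj₁ v∈S) z≤n

    choice : (v : Fin n) → Σ ℕ λ m →
      (∀ u → Earlier (toℕ v) v u → stage (toℕ v) u ≢ m) ×
      (∀ j → j < m → ∃[ u ] (Earlier (toℕ v) v u × stage (toℕ v) u ≡ j))
    choice v = mex (Earlier (toℕ v) v) (Earlier? (toℕ v) v) (stage (toℕ v))

    c-choice : ∀ v → ¬ S v → c v ≡ proj₁ (choice v)
    c-choice v v∉S = trans (stage-stable (suc (toℕ v)) n v (inj₂ ≤-refl) (toℕ<n v)) chosen
      where
      chosen : stage (suc (toℕ v)) v ≡ proj₁ (choice v)
      chosen with S? v | toℕ v ≟ toℕ v
      ... | yes v∈S | _       = ⊥-elim (v∉S v∈S)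
      ... | no _    | no v≢v  = ⊥-elim (v≢v refl)
      ... | no _    | yes _   = refl

    c-earlier : ∀ v u → Coloured (toℕ v) u → c u ≡ stage (toℕ v) u
    c-earlier v u col = stage-stable (toℕ v) n u col (<⇒≤ (toℕ<n v))

    avoids-earlier : ∀ v → ¬ S v → ∀ u → E G v u → Coloured (toℕ v) u → c u ≢ c v
    avoids-earlier v v∉S u e col eq = proj₁ (proj₂ (choice v)) u (e , col)
      (trans (sym (c-earlier v u col)) (trans eq (c-choice v v∉S)))

    c-proper : ∀ u v → E G u v → c u ≢ c v
    c-proper u v e with S? u | S? v
    ... | yes u∈S | yes v∈S = λ eq →
      seed-proper u v u∈S v∈S e (trans (sym (c-seed u u∈S)) (trans eq (c-seed v v∈S)))
    ... | yes u∈S | no v∉S  = avoids-earlier v v∉S u (E-sym G e) (inj₁ u∈S)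
    ... | no u∉S  | yes v∈S = λ eq → avoids-earlier u u∉S v e (inj₁ v∈S) (sym eq)
    ... | no u∉S  | no v∉S with <-cmp (toℕ u) (toℕ v)
    ...   | tri< u<v _ _ = avoids-earlier v v∉S u (E-sym G e) (inj₂ u<v)
    ...   | tri> _ _ v<u = λ eq → avoids-earlier u u∉S v e (inj₂ v<u) (sym eq)
    ...   | tri≈ _ u≡v _ with toℕ-injective u≡v
    ...     | refl = λ _ → true≢false (trans (sym e) (Graph.irrefl G u))
      where
      true≢false : true ≢ false
      true≢false ()

    c-grundy : ∀ v j → j < c v → ∃[ u ] (E G v u × c u ≡ j)
    c-grundy v j j<cv with S? v
    ... | yes v∈S with seed-grundy v v∈S j (subst (j <_) (c-seed v v∈S) j<cv)
    ...   | u , u∈S , e , eq = u , e , trans (c-seed u u∈S) eq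
    c-grundy v j j<cv | no v∉S with proj₂ (proj₂ (choice v)) j (subst (j <_) (c-choice v v∉S) j<cv)
    ... | u , (e , col) , eq = u , e , trans (c-earlier v u col) eq

    grundy-extension : Fin n →
      Σ ℕ λ k → Σ (Fin n → Fin k) λ φ → Grundy G φ × (∀ v → S v → toℕ (φ v) ≡ c0 v)
    grundy-extension v0 with argmax c v0
    ... | w , w-max = suc (c w) , φ , (φ-proper , φ-onto , φ-grundy) , φ-seed
      where
      bounded : ∀ v → c v < suc (c w)
      bounded v = s≤s (w-max v)
      φ : Fin n → Fin (suc (c w))
      φ v = fromℕ< (bounded v)
      toℕ-φ : ∀ v → toℕ (φ v) ≡ c v
      toℕ-φ v = toℕ-fromℕ< (bounded v)
      φ-proper : Proper G φ
      φ-proper u v e eq = c-proper u v e (trans (sym (toℕ-φ u)) (trans (cong toℕ eq) (toℕ-φ v)))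
      φ-grundy : ∀ v (i : Fin (suc (c w))) → toℕ i < toℕ (φ v) → ∃[ u ] (E G v u × φ u ≡ i)
      φ-grundy v i lt with c-grundy v (toℕ i) (subst (toℕ i <_) (toℕ-φ v) lt)
      ... | u , e , eq = u , e , toℕ-injective (trans (toℕ-φ u) eq)
      -- the top colour is used by w, every smaller one by a neighbour of w
      φ-onto : UsesAll G φ
      φ-onto i with toℕ i ≟ c w
      ... | yes eq = w , λ { refl → toℕ-injective (trans (toℕ-φ w) (sym eq)) }
      ... | no ne with c-grundy w (toℕ i) (≤∧≢⇒< (s≤s⁻¹ (toℕ<n i)) ne)
      ...   | u , _ , eq = u , λ { refl → toℕ-injective (trans (toℕ-φ u) eq) }
      φ-seed : ∀ v → S v → toℕ (φ v) ≡ c0 v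
      φ-seed v v∈S = trans (toℕ-φ v) (c-seed v v∈S)

module OrderBound where
  open Counting
  open Greedy using (module GreedyExtension)
  open import Data.Nat using (ℕ; zero; suc; _+_; _≤_; _<_; z≤n; s≤s⁻¹; _≤?_)
  open import Data.Nat.Properties
  open import Data.Fin using (Fin; zero; suc; toℕ; fromℕ; fromℕ<; inject≤)
  open import Data.Fin.Properties
    using (toℕ-injective; toℕ-fromℕ<; toℕ-fromℕ; toℕ-inject≤; toℕ<n; any?) renaming (_≟_ to _≟ᶠ_)
  open import Data.Sum using (_⊎_; inj₁; inj₂)
  open import Data.Product using (Σ; ∃-syntax; _×_; _,_; proj₁; proj₂)
  open import Data.Empty using (⊥; ⊥-elim)
  open import Relation.Nullary using (¬_; Dec; yes; no; ¬?)
  open import Relation.Nullary.Decidable using (_×-dec_; _⊎-dec_)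
  open import Relation.Binary.PropositionalEquality using (_≡_; _≢_; refl; sym; trans; cong; subst)
  open Enum

  -- Structure of a complete colouring φ of G with k colours: each class has a
  -- representative, and the classes with a second vertex ("shared" classes)
  -- contribute one more vertex each.
  module CompleteColouring {n k : ℕ} (G : Graph n) (φ : Fin n → Fin k) (φ-complete : Complete G φ) where

    φ-proper : Proper G φ
    φ-proper = proj₁ φ-complete

    φ-onto : UsesAll G φ
    φ-onto = proj₁ (proj₂ φ-complete)

    φ-edges : ∀ (i j : Fin k) → i ≢ j → ∃[ u ] ∃[ v ] (E G u v × φ u ≡ i × φ v ≡ j)
    φ-edges = proj₂ (proj₂ φ-complete)

    rep : Fin k → Fin n
    rep c = proj₁ (φ-onto c)

    φ-rep : ∀ c → φ (rep c) ≡ c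
    φ-rep c = proj₂ (φ-onto c) refl

    Shared : Fin k → Set
    Shared c = ∃[ v ] (φ v ≡ c × v ≢ rep c)

    Shared? : ∀ c → Dec (Shared c)
    Shared? c = any? (λ v → (φ v ≟ᶠ c) ×-dec ¬? (v ≟ᶠ rep c))

    singleton : ∀ {c u} → ¬ Shared c → φ u ≡ c → u ≡ rep c
    singleton {c} {u} not-shared φu≡c with u ≟ᶠ rep c
    ... | yes u≡rep = u≡rep
    ... | no u≢rep  = ⊥-elim (not-shared (u , φu≡c , u≢rep))

    shared-enum : Enum k Shared
    shared-enum = enumerate Shared Shared?

    single-enum : Enum k (λ c → ¬ Shared c)
    single-enum = enumerate (λ c → ¬ Shared c) (λ c → ¬? (Shared? c))

    #shared #single : ℕ
    #shared = cnt shared-enum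
    #single = cnt single-enum

    #shared+#single : #shared + #single ≡ k
    #shared+#single = count-split Shared Shared?

    -- representatives plus second vertices of the shared classes are distinct
    vertex-count : k + #shared ≤ n
    vertex-count = injective-from-⊎ pick pick-inj
      where
      second : Fin #shared → Fin n
      second j = proj₁ (enumP shared-enum j)
      pick : Fin k ⊎ Fin #shared → Fin n
      pick (inj₁ c) = rep c
      pick (inj₂ j) = second j
      φ-second : ∀ j → φ (second j) ≡ enum shared-enum j
      φ-second j = proj₁ (proj₂ (enumP shared-enum j))
      second≢rep : ∀ c j → rep c ≢ second j
      second≢rep c j e with trans (sym (φ-rep c)) (trans (cong φ e) (φ-second j))
      ... | refl = proj₂ (proj₂ (enumP shared-enum j)) (sym e)
      pick-inj : ∀ {x y} → pick x ≡ pick y → x ≡ y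
      pick-inj {inj₁ c} {inj₁ c'} e = cong inj₁ (trans (sym (φ-rep c)) (trans (cong φ e) (φ-rep c')))
      pick-inj {inj₁ c} {inj₂ j}  e = ⊥-elim (second≢rep c j e)
      pick-inj {inj₂ j} {inj₁ c}  e = ⊥-elim (second≢rep c j (sym e))
      pick-inj {inj₂ j} {inj₂ j'} e =
        cong inj₂ (enum-inj shared-enum (trans (sym (φ-second j)) (trans (cong φ e) (φ-second j'))))

    -- If f singleton classes and one further class d exist, colouring d by 0
    -- and the i-th singleton class by i+1 is a partial Grundy colouring (by
    -- completeness); its greedy extension has more than f colours.
    module ManySingletons (f : ℕ) (f<k : f < k) (f≤#single : f ≤ #single) where

      σ : Fin f → Fin k
      σ i = enum single-enum (inject≤ i f≤#single)

      σ-single : ∀ i → ¬ Shared (σ i)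
      σ-single i = enumP single-enum (inject≤ i f≤#single)

      σ-inj : ∀ {i j} → σ i ≡ σ j → i ≡ j
      σ-inj {i} {j} e = toℕ-injective (trans (sym (toℕ-inject≤ i f≤#single))
        (trans (cong toℕ (enum-inj single-enum e)) (toℕ-inject≤ j f≤#single)))

      d : Fin k
      d = proj₁ (missed-value σ f<k)

      σ≢d : ∀ i → σ i ≢ d
      σ≢d = proj₂ (missed-value σ f<k)

      SeedColour : Fin k → Set
      SeedColour c = c ≡ d ⊎ ∃[ i ] σ i ≡ c

      rank : Fin k → ℕ
      rank c with c ≟ᶠ d | any? (λ i → σ i ≟ᶠ c)
      ... | yes _ | _           = 0
      ... | no _  | yes (i , _) = suc (toℕ i)
      ... | no _  | no _        = 0

      rank-d : rank d ≡ 0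
      rank-d with d ≟ᶠ d
      ... | yes _ = refl
      ... | no d≢d = ⊥-elim (d≢d refl)

      rank-σ : ∀ i → rank (σ i) ≡ suc (toℕ i)
      rank-σ i with σ i ≟ᶠ d | any? (λ i' → σ i' ≟ᶠ σ i)
      ... | yes e | _           = ⊥-elim (σ≢d i e)
      ... | no _  | yes (i' , e) = cong (λ x → suc (toℕ x)) (σ-inj e)
      ... | no _  | no none      = ⊥-elim (none (i , refl))

      rank-inj : ∀ {c c'} → SeedColour c → SeedColour c' → rank c ≡ rank c' → c ≡ c'
      rank-inj (inj₁ refl) (inj₁ refl) _ = refl
      rank-inj (inj₁ refl) (inj₂ (j , refl)) e with trans (sym rank-d) (trans e (rank-σ j))
      ... | ()
      rank-inj (inj₂ (i , refl)) (inj₁ refl) e with trans (sym rank-d) (trans (sym e) (rank-σ i))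
      ... | ()
      rank-inj (inj₂ (i , refl)) (inj₂ (j , refl)) e =
        cong σ (toℕ-injective (suc-injective (trans (sym (rank-σ i)) (trans e (rank-σ j)))))

      S : Fin n → Set
      S v = SeedColour (φ v)

      S? : ∀ v → Dec (S v)
      S? v = (φ v ≟ᶠ d) ⊎-dec any? (λ i → σ i ≟ᶠ φ v)

      seed-proper : ∀ u v → S u → S v → E G u v → rank (φ u) ≢ rank (φ v)
      seed-proper u v u∈S v∈S e eq = φ-proper u v e (rank-inj u∈S v∈S eq)

      sees : ∀ i v → φ v ≡ σ i → ∀ c → c ≢ σ i → ∃[ u ] (E G v u × φ u ≡ c)
      sees i v φv c c≢σi with φ-edges (σ i) c (λ e → c≢σi (sym e))
      ... | x , y , exy , φx , φy with trans (singleton (σ-single i) φv) (sym (singleton (σ-single i) φx))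
      ...   | refl = y , exy , φy

      seed-grundy : ∀ v → S v → ∀ j → j < rank (φ v) → ∃[ u ] (S u × E G v u × rank (φ u) ≡ j)
      seed-grundy v (inj₁ φv≡d) j j<r = ⊥-elim (≮0 (subst (j <_) (trans (cong rank φv≡d) rank-d) j<r))
        where
        ≮0 : ¬ (j < 0)
        ≮0 ()
      seed-grundy v (inj₂ (i , σi≡φv)) zero _ with sees i v (sym σi≡φv) d (λ e → σ≢d i (sym e))
      ... | u , e , φu≡d = u , inj₁ φu≡d , e , trans (cong rank φu≡d) rank-d
      seed-grundy v (inj₂ (i , σi≡φv)) (suc j) j<r with sees i v (sym σi≡φv) (σ i') σi'≢σi
        where
        j<i : j < toℕ i
        j<i = s≤s⁻¹ (subst (suc j <_) (trans (cong rank (sym σi≡φv)) (rank-σ i)) j<r)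
        i' : Fin f
        i' = fromℕ< (<-trans j<i (toℕ<n i))
        σi'≢σi : σ i' ≢ σ i
        σi'≢σi e = <⇒≢ j<i (trans (sym (toℕ-fromℕ< (<-trans j<i (toℕ<n i)))) (cong toℕ (σ-inj e)))
      ... | u , e , φu≡σi' = u , inj₂ (_ , sym φu≡σi') , e ,
            trans (cong rank φu≡σi') (trans (rank-σ _) (cong suc (toℕ-fromℕ< _)))

      open GreedyExtension G S S? (λ v → rank (φ v)) seed-proper seed-grundy using (grundy-extension)

      -- the extension uses colour i + 1 on σ i, hence more than f colours
      too-many-colours : (∀ k' → Σ (Fin n → Fin k') (Grundy G) → k' ≤ f) → ⊥
      too-many-colours Γ≤f with grundy-extension (rep d)
      ... | k' , ψ , ψ-grundy , ψ-seed = <⇒≱ (more f refl) (Γ≤f k' (ψ , ψ-grundy))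
        where
        more : ∀ f' → f' ≡ f → f' < k'
        more zero _ = ≤-<-trans z≤n (toℕ<n (ψ (rep d)))
        more (suc f') refl = subst (_< k')
          (trans (ψ-seed top (inj₂ (fromℕ f' , sym (φ-rep _))))
            (trans (cong rank (φ-rep _)) (trans (rank-σ _) (cong suc (toℕ-fromℕ f')))))
          (toℕ<n (ψ top))
          where
          top : Fin n
          top = rep (σ (fromℕ f'))

  -- Fewer than f classes can be
  -- singletons, and every other class contributes two vertices.
  complete-colouring-order : ∀ {n k} (G : Graph n) (f : ℕ) →
    (∀ k' → Σ (Fin n → Fin k') (Grundy G) → k' ≤ f) →
    (φ : Fin n → Fin k) → Complete G φ → f < k → k + k < n + f
  complete-colouring-order {n} {k} G f Γ≤f φ φ-complete f<k = begin-strict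
      k + k                   ≡⟨ cong (k +_) (sym #shared+#single) ⟩
      k + (#shared + #single) ≡⟨ sym (+-assoc k #shared #single) ⟩
      k + #shared + #single   <⟨ +-mono-≤-< vertex-count few-singletons ⟩
      n + f                   ∎
    where
    open CompleteColouring G φ φ-complete
    open ≤-Reasoning
    few-singletons : #single < f
    few-singletons with f ≤? #single
    ... | no f≰ = ≰⇒> f≰
    ... | yes f≤ = ⊥-elim (ManySingletons.too-many-colours f f<k f≤ Γ≤f)

module Presentation where
  open import Data.Nat using (ℕ; _<_)
  open import Data.Fin using (Fin; toℕ)
  open import Data.Bool using (false)
  open import Data.Product using (∃-syntax; _×_; _,_)
  open import Data.Empty using (⊥-elim)
  open import Relation.Nullary using (¬_; Dec; yes; no; does)
  open import Relation.Binary.PropositionalEquality using (_≡_; _≢_; refl; sym; trans; cong; subst; subst₂)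

  -- Colourings and walks are transported
  -- along the bijection, so the combinatorics can be done on V.
  module Presented {V : Set} {N : ℕ} (to : Fin N → V) (from : V → Fin N)
    (to-from : ∀ x → to (from x) ≡ x) (from-to : ∀ u → from (to u) ≡ u)
    (Adj : V → V → Set) (Adj? : ∀ x y → Dec (Adj x y))
    (Adj-sym : ∀ {x y} → Adj x y → Adj y x) (Adj-irrefl : ∀ {x} → ¬ Adj x x) where

    G : Graph N
    G = record
      { adj = λ u v → does (Adj? (to u) (to v))
      ; sym = λ u v → agree (Adj? (to u) (to v)) (Adj? (to v) (to u))
      ; irrefl = λ u → irrefl (Adj? (to u) (to u)) }
      where
      agree : ∀ {x y} (a : Dec (Adj x y)) (b : Dec (Adj y x)) → does a ≡ does b
      agree (yes _)  (yes _)  = refl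
      agree (no _)   (no _)   = refl
      agree (yes xy) (no ¬yx) = ⊥-elim (¬yx (Adj-sym xy))
      agree (no ¬xy) (yes yx) = ⊥-elim (¬xy (Adj-sym yx))
      irrefl : ∀ {x} (a : Dec (Adj x x)) → does a ≡ false
      irrefl (yes xx) = ⊥-elim (Adj-irrefl xx)
      irrefl (no _)   = refl

    E⇒Adj : ∀ {u v} → E G u v → Adj (to u) (to v)
    E⇒Adj {u} {v} e with Adj? (to u) (to v)
    ... | yes a = a

    Adj⇒E : ∀ {u v} → Adj (to u) (to v) → E G u v
    Adj⇒E {u} {v} a with Adj? (to u) (to v)
    ... | yes _  = refl
    ... | no ¬a  = ⊥-elim (¬a a)

    Adj⇒E-from : ∀ {x y} → Adj x y → E G (from x) (from y)
    Adj⇒E-from {x} {y} a = Adj⇒E (subst₂ Adj (sym (to-from x)) (sym (to-from y)) a)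

    step-from : ∀ {x y v} → Adj x y → Reachable G (from y) v → Reachable G (from x) v
    step-from a r = step (Adj⇒E-from a) r

    ProperV : ∀ {k} → (V → Fin k) → Set
    ProperV c = ∀ x y → Adj x y → c x ≢ c y

    OntoV : ∀ {k} → (V → Fin k) → Set
    OntoV {k} c = ∀ (i : Fin k) → ∃[ x ] c x ≡ i

    GrundyV : ∀ {k} → (V → Fin k) → Set
    GrundyV {k} c = ProperV c × OntoV c ×
      (∀ x (i : Fin k) → toℕ i < toℕ (c x) → ∃[ y ] (Adj x y × c y ≡ i))

    CompleteV : ∀ {k} → (V → Fin k) → Set
    CompleteV {k} c = ProperV c × OntoV c ×
      (∀ (i j : Fin k) → i ≢ j → ∃[ x ] ∃[ y ] (Adj x y × c x ≡ i × c y ≡ j))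

    proper-lift : ∀ {k} (c : V → Fin k) → ProperV c → Proper G (λ u → c (to u))
    proper-lift c c-proper u v e = c-proper (to u) (to v) (E⇒Adj e)

    onto-lift : ∀ {k} (c : V → Fin k) → OntoV c → UsesAll G (λ u → c (to u))
    onto-lift c c-onto i with c-onto i
    ... | x , cx≡i = from x , λ { refl → trans (cong c (to-from x)) cx≡i }

    grundy-lift : ∀ {k} (c : V → Fin k) → GrundyV c → Grundy G (λ u → c (to u))
    grundy-lift c (c-proper , c-onto , c-grundy) =
      proper-lift c c-proper , onto-lift c c-onto , λ u i lt → lift u (c-grundy (to u) i lt)
      where
      lift : ∀ {i} u → ∃[ y ] (Adj (to u) y × c y ≡ i) → ∃[ v ] (E G u v × c (to v) ≡ i)
      lift u (y , a , cy) =
        from y , subst (λ w → E G w (from y)) (from-to u) (Adj⇒E-from a) , trans (cong c (to-from y)) cy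

    complete-lift : ∀ {k} (c : V → Fin k) → CompleteV c → Complete G (λ u → c (to u))
    complete-lift c (c-proper , c-onto , c-edges) =
      proper-lift c c-proper , onto-lift c c-onto , λ i j i≢j → lift (c-edges i j i≢j)
      where
      lift : ∀ {i j} → ∃[ x ] ∃[ y ] (Adj x y × c x ≡ i × c y ≡ j) →
        ∃[ u ] ∃[ v ] (E G u v × c (to u) ≡ i × c (to v) ≡ j)
      lift (x , y , a , cx , cy) =
        from x , from y , Adj⇒E-from a , trans (cong c (to-from x)) cx , trans (cong c (to-from y)) cy

    grundy-pull : ∀ {k} (ψ : Fin N → Fin k) → Grundy G ψ → GrundyV (λ x → ψ (from x))
    grundy-pull ψ (ψ-proper , ψ-onto , ψ-grundy) = proper , onto , grundy
      where
      proper : ProperV (λ x → ψ (from x))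
      proper x y a = ψ-proper (from x) (from y) (Adj⇒E-from a)
      onto : OntoV (λ x → ψ (from x))
      onto i with ψ-onto i
      ... | u , ψu≡i = to u , trans (cong ψ (from-to u)) (ψu≡i refl)
      grundy : ∀ x i → toℕ i < toℕ (ψ (from x)) → ∃[ y ] (Adj x y × ψ (from y) ≡ i)
      grundy x i lt with ψ-grundy (from x) i lt
      ... | v , e , ψv≡i = to v , subst (λ z → Adj z (to v)) (to-from x) (E⇒Adj e) ,
                            trans (cong ψ (from-to v)) ψv≡i

module HalfGraph where
  open import Data.Nat using (ℕ; zero; suc; _≤_; _<_; z≤n; s≤s)
  open import Data.Nat.Properties using (<-trans; <-≤-trans; ≤-<-trans; <-irrefl; ≰⇒>; _≤?_)
  open import Data.Fin using (Fin; zero; suc; toℕ)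
  open import Data.Fin.Properties using () renaming (_≟_ to _≟ᶠ_)
  open import Data.Unit using (⊤; tt)
  open import Data.Sum using (_⊎_; inj₁; inj₂)
  open import Data.Product using (∃-syntax; _×_; _,_; proj₁; proj₂)
  open import Data.Empty using (⊥; ⊥-elim)
  open import Relation.Nullary using (¬_; Dec; yes; no)
  open import Relation.Binary.PropositionalEquality using (_≡_; _≢_; refl; sym; trans; cong)

  data Half (t : ℕ) : Set where
    apex : Half t
    L    : Fin (suc t) → Half t
    R    : Fin (suc (suc t)) → Half t

  data HAdj {t : ℕ} : Half t → Half t → Set where
    L-R     : ∀ {i j} → toℕ j ≤ toℕ i → HAdj (L i) (R j)
    R-L     : ∀ {i j} → toℕ j ≤ toℕ i → HAdj (R j) (L i)
    apex-R  : ∀ {j} → HAdj apex (R j)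
    R-apex  : ∀ {j} → HAdj (R j) apex
    apex-L₀ : HAdj apex (L zero)
    L₀-apex : HAdj (L zero) apex

  HAdj-sym : ∀ {t} {x y : Half t} → HAdj x y → HAdj y x
  HAdj-sym (L-R j≤i) = R-L j≤i
  HAdj-sym (R-L j≤i) = L-R j≤i
  HAdj-sym apex-R    = R-apex
  HAdj-sym R-apex    = apex-R
  HAdj-sym apex-L₀   = L₀-apex
  HAdj-sym L₀-apex   = apex-L₀

  HAdj? : ∀ {t} (x y : Half t) → Dec (HAdj x y)
  HAdj? apex        apex        = no λ ()
  HAdj? apex        (L zero)    = yes apex-L₀
  HAdj? apex        (L (suc i)) = no λ ()
  HAdj? apex        (R j)       = yes apex-R
  HAdj? (L zero)    apex        = yes L₀-apex
  HAdj? (L (suc i)) apex        = no λ ()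
  HAdj? (L i)       (L i')      = no λ ()
  HAdj? (L i)       (R j) with toℕ j ≤? toℕ i
  ... | yes j≤i = yes (L-R j≤i)
  ... | no j≰i  = no λ { (L-R j≤i) → j≰i j≤i }
  HAdj? (R j)       apex        = yes R-apex
  HAdj? (R j)       (L i) with toℕ j ≤? toℕ i
  ... | yes j≤i = yes (R-L j≤i)
  ... | no j≰i  = no λ { (R-L j≤i) → j≰i j≤i }
  HAdj? (R j)       (R j')      = no λ ()

  HAdj-irrefl : ∀ {t} {x : Half t} → ¬ HAdj x x
  HAdj-irrefl ()

  IsR : ∀ {t} → Half t → Set
  IsR (R _) = ⊤
  IsR _     = ⊥

  IsR? : ∀ {t} (x : Half t) → Dec (IsR x)
  IsR? apex  = no λ ()
  IsR? (L _) = no λ ()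
  IsR? (R _) = yes tt

  R-nbr-not-R : ∀ {t} {x y : Half t} → IsR x → HAdj x y → ¬ IsR y
  R-nbr-not-R _ (R-L _) ()
  R-nbr-not-R _ R-apex  ()

  module FourLayers {t k : ℕ} (c : Half t → Fin k) (c-proper : ∀ {x y} → HAdj x y → c x ≢ c y)
    (ℓ : Fin 4 → Fin k) where

    Dom : Fin k → Half t → Set
    Dom a x = ∃[ y ] (HAdj x y × c y ≡ a)

    Layered : Set
    Layered = ∀ x (i j : Fin 4) → toℕ i < toℕ j → c x ≡ ℓ j → Dom (ℓ i) x

    p q r s : Fin k
    p = ℓ zero
    q = ℓ (suc zero)
    r = ℓ (suc (suc zero))
    s = ℓ (suc (suc (suc zero)))

    not-adjacent : ∀ {x y} → c x ≡ c y → ¬ HAdj x y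
    not-adjacent cx≡cy x~y = c-proper x~y cx≡cy

    crossing : ∀ {a e} → c (L a) ≡ c (R e) → toℕ a < toℕ e
    crossing {a} {e} same with toℕ e ≤? toℕ a
    ... | yes e≤a = ⊥-elim (not-adjacent same (L-R e≤a))
    ... | no e≰a  = ≰⇒> e≰a

    module Configuration (layered : Layered) (v : Half t) (cv≡s : c v ≡ s) where

      vq-dom : Dom q v
      vq-dom = layered v (suc zero) (suc (suc (suc zero))) (s≤s (s≤s z≤n)) cv≡s
      w-dom : Dom r v
      w-dom = layered v (suc (suc zero)) (suc (suc (suc zero))) (s≤s (s≤s (s≤s z≤n))) cv≡s

      vq w : Half t
      vq = proj₁ vq-dom
      w  = proj₁ w-dom

      v~vq : HAdj v vq
      v~vq = proj₁ (proj₂ vq-dom)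
      v~w : HAdj v w
      v~w = proj₁ (proj₂ w-dom)

      z-dom : Dom q w
      z-dom = layered w (suc zero) (suc (suc zero)) (s≤s (s≤s z≤n)) (proj₂ (proj₂ w-dom))

      z : Half t
      z = proj₁ z-dom

      w~z : HAdj w z
      w~z = proj₁ (proj₂ z-dom)

      v-Dp : Dom p v
      v-Dp = layered v zero (suc (suc (suc zero))) (s≤s z≤n) cv≡s
      vq-Dp : Dom p vq
      vq-Dp = layered vq zero (suc zero) (s≤s z≤n) (proj₂ (proj₂ vq-dom))
      w-Dp : Dom p w
      w-Dp = layered w zero (suc (suc zero)) (s≤s z≤n) (proj₂ (proj₂ w-dom))
      z-Dp : Dom p z
      z-Dp = layered z zero (suc zero) (s≤s z≤n) (proj₂ (proj₂ z-dom))

      cvq≡cz : c vq ≡ c z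
      cvq≡cz = trans (proj₂ (proj₂ vq-dom)) (sym (proj₂ (proj₂ z-dom)))

      vq≢w : vq ≢ w
      vq≢w vq≡w = c-proper w~z (trans (cong c (sym vq≡w)) cvq≡cz)

      -- If the p-dominated vertices lie in a set D inducing a matching, then
      -- vq and w are both the D-neighbour of v, which is impossible.
      matching-argument : (D : Half t → Set) → (∀ {x} → Dom p x → D x) →
        (∀ {x y y'} → D x → D y → D y' → HAdj x y → HAdj x y' → y ≡ y') → ⊥
      matching-argument D dom⇒D matching =
        vq≢w (matching (dom⇒D v-Dp) (dom⇒D vq-Dp) (dom⇒D w-Dp) v~vq v~w)

    -- Case A: the apex has colour p. Then p-dominated vertices lie in
    -- {R_j} ∪ {L_0}, which induces the single edge L_0 R_0.
    module ApexColoured (apex-p : c apex ≡ p) where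

      InD : Half t → Set
      InD x = IsR x ⊎ x ≡ L zero

      dom⇒D : ∀ {x} → Dom p x → InD x
      dom⇒D {apex} (y , a~y , cy≡p) = ⊥-elim (c-proper a~y (trans apex-p (sym cy≡p)))
      dom⇒D {L zero} _ = inj₂ refl
      dom⇒D {L (suc i)} (R j , L-R _ , cy≡p) = ⊥-elim (c-proper (R-apex {j = j}) (trans cy≡p (sym apex-p)))
      dom⇒D {R j} _ = inj₁ tt

      R-nbr : ∀ {j y} → HAdj (R j) y → InD y → y ≡ L zero
      R-nbr (R-L _) (inj₂ refl) = refl
      R-nbr R-apex  (inj₁ ())
      R-nbr R-apex  (inj₂ ())

      L₀-nbr : ∀ {y} → HAdj (L zero) y → InD y → y ≡ R zero
      L₀-nbr (L-R {j = zero} _) _ = refl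
      L₀-nbr L₀-apex (inj₁ ())
      L₀-nbr L₀-apex (inj₂ ())

      matching : ∀ {x y y'} → InD x → InD y → InD y' → HAdj x y → HAdj x y' → y ≡ y'
      matching {R j} _ Dy Dy' x~y x~y' = trans (R-nbr x~y Dy) (sym (R-nbr x~y' Dy'))
      matching {L zero} _ Dy Dy' x~y x~y' = trans (L₀-nbr x~y Dy) (sym (L₀-nbr x~y' Dy'))
      matching {apex} (inj₁ ()) _ _ _ _
      matching {apex} (inj₂ ()) _ _ _ _
      matching {L (suc i)} (inj₁ ()) _ _ _ _
      matching {L (suc i)} (inj₂ ()) _ _ _ _

    -- Case B: R_0 has colour p. Then colour p lives on R-vertices only, so the
    -- p-dominated vertices lie among apex and L's, inducing the edge a L_0.
    module R₀Coloured (R₀-p : c (R zero) ≡ p) where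

      InD : Half t → Set
      InD x = ¬ IsR x

      sees-R₀ : ∀ {j} {y : Half t} → HAdj (R j) y → HAdj y (R zero)
      sees-R₀ (R-L _) = L-R z≤n
      sees-R₀ R-apex  = apex-R

      dom⇒D : ∀ {x} → Dom p x → InD x
      dom⇒D {apex} _ ()
      dom⇒D {L _} _ ()
      dom⇒D {R j} (y , x~y , cy≡p) _ = c-proper (sees-R₀ x~y) (trans cy≡p (sym R₀-p))

      apex-nbr : ∀ {y} → HAdj apex y → InD y → y ≡ L zero
      apex-nbr apex-R  Dy = ⊥-elim (Dy tt)
      apex-nbr apex-L₀ _  = refl

      L₀-nbr : ∀ {y} → HAdj (L zero) y → InD y → y ≡ apex
      L₀-nbr (L-R _) Dy = ⊥-elim (Dy tt)
      L₀-nbr L₀-apex _  = refl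

      matching : ∀ {x y y'} → InD x → InD y → InD y' → HAdj x y → HAdj x y' → y ≡ y'
      matching {apex} _ Dy Dy' x~y x~y' = trans (apex-nbr x~y Dy) (sym (apex-nbr x~y' Dy'))
      matching {L zero} _ Dy Dy' x~y x~y' = trans (L₀-nbr x~y Dy) (sym (L₀-nbr x~y' Dy'))
      matching {L (suc i)} _ Dy _ (L-R _) _ = ⊥-elim (Dy tt)
      matching {R j} Dx _ _ _ _ = ⊥-elim (Dx tt)

    module Uncoloured (apex-not-p : c apex ≢ p) (R₀-not-p : c (R zero) ≢ p) where

      L₀-undominated : ¬ Dom p (L zero)
      L₀-undominated (R zero , L-R _ , cy≡p) = R₀-not-p cy≡p
      L₀-undominated (apex , L₀-apex , cy≡p) = apex-not-p cy≡p

      dom-nbr-is-R : ∀ {x y} → ¬ IsR x → Dom p x → HAdj x y → Dom p y → IsR y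
      dom-nbr-is-R _ _ apex-R _ = tt
      dom-nbr-is-R _ _ apex-L₀ Dy = ⊥-elim (L₀-undominated Dy)
      dom-nbr-is-R _ Dx L₀-apex _ = ⊥-elim (L₀-undominated Dx)
      dom-nbr-is-R _ _ (L-R _) _ = tt
      dom-nbr-is-R notR _ (R-L _) _ = ⊥-elim (notR tt)
      dom-nbr-is-R notR _ R-apex _ = ⊥-elim (notR tt)

      -- For x = L_a, the p-neighbours R_b of
      -- L_a and L_g of R_e give b ≤ a < e ≤ g < b by the crossing property.
      mixed-class : ∀ {x y} → c x ≡ c y → ¬ IsR x → IsR y → Dom p x → Dom p y → ⊥
      mixed-class {apex} {R e} same _ _ _ _ = not-adjacent same apex-R
      mixed-class {L a} {R e} same _ _ (R b , L-R b≤a , cRb≡p) (L g , R-L e≤g , cLg≡p) =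
        <-irrefl refl (≤-<-trans b≤a (<-trans (<-≤-trans (crossing same) e≤g) (crossing (trans cLg≡p (sym cRb≡p)))))
      mixed-class {L zero} {R e} _ _ _ (apex , L₀-apex , ca≡p) _ = apex-not-p ca≡p
      mixed-class {L a} {R e} _ _ _ _ (apex , R-apex , ca≡p) = apex-not-p ca≡p
      mixed-class {R _} _ notR _ _ _ = notR tt

    no-fourth-layer : Layered → ∀ v → c v ≢ s
    no-fourth-layer layered v cv≡s with c apex ≟ᶠ p | c (R zero) ≟ᶠ p
    ... | yes apex-p | _ = matching-argument InD dom⇒D matching
      where open Configuration layered v cv≡s
            open ApexColoured apex-p
    ... | no _ | yes R₀-p = matching-argument InD dom⇒D matching
      where open Configuration layered v cv≡s
            open R₀Coloured R₀-p
    ... | no apex-not-p | no R₀-not-p with IsR? v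
    ...   | yes v∈R = mixed-class cvq≡cz (R-nbr-not-R v∈R v~vq) z∈R vq-Dp z-Dp
      where open Configuration layered v cv≡s
            open Uncoloured apex-not-p R₀-not-p
            z∈R : IsR z
            z∈R = dom-nbr-is-R (R-nbr-not-R v∈R v~w) w-Dp w~z z-Dp
    ...   | no v∉R = mixed-class (sym cvq≡cz) (R-nbr-not-R w∈R w~z) vq∈R z-Dp vq-Dp
      where open Configuration layered v cv≡s
            open Uncoloured apex-not-p R₀-not-p
            vq∈R : IsR vq
            vq∈R = dom-nbr-is-R v∉R v-Dp v~vq vq-Dp
            w∈R : IsR w
            w∈R = dom-nbr-is-R v∉R v-Dp v~w w-Dp

module JoinGraph (m t : ℕ) where
  open Counting
  open GraphFacts using (connected-via-hub; clique-bound)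
  open Presentation using (module Presented)
  open HalfGraph
  open import Data.Nat using (ℕ; zero; suc; _+_; _≤_; _<_; z≤n; s≤s; s≤s⁻¹; _≤?_)
  open import Data.Nat.Properties using (+-comm; +-monoʳ-≤; ≤-trans; <⇒≱; ≰⇒>; <-cmp; <⇒≢; 1+n≰n)
  open import Data.Fin using (Fin; zero; suc; toℕ; join; splitAt; inject≤)
  open import Data.Fin.Properties
    using (splitAt-join; join-splitAt; toℕ-inject≤; toℕ-injective; suc-injective)
    renaming (_≟_ to _≟ᶠ_)
  open import Data.Sum using (_⊎_; inj₁; inj₂; [_,_]′)
  open import Data.Sum.Properties using (inj₂-injective)
  open import Data.Product using (Σ; ∃-syntax; _×_; _,_; proj₁; proj₂)
  open import Data.Empty using (⊥; ⊥-elim)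
  open import Relation.Nullary using (¬_; Dec; yes; no)
  open import Relation.Binary.PropositionalEquality using (_≡_; _≢_; refl; sym; trans; cong; subst; subst₂)
  open import Relation.Binary.Definitions using (tri<; tri≈; tri>)
  open Enum


  data Vertex : Set where
    clq  : Fin m → Vertex
    half : Half t → Vertex

  data Adj : Vertex → Vertex → Set where
    clq-clq   : ∀ {a b} → a ≢ b → Adj (clq a) (clq b)
    clq-half  : ∀ {a x} → Adj (clq a) (half x)
    half-clq  : ∀ {a x} → Adj (half x) (clq a)
    half-half : ∀ {x y} → HAdj x y → Adj (half x) (half y)

  Adj? : ∀ x y → Dec (Adj x y)
  Adj? (clq a) (clq b) with a ≟ᶠ b
  ... | yes a≡b = no λ { (clq-clq a≢b) → a≢b a≡b }
  ... | no a≢b  = yes (clq-clq a≢b)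
  Adj? (clq a)  (half x) = yes clq-half
  Adj? (half x) (clq a)  = yes half-clq
  Adj? (half x) (half y) with HAdj? x y
  ... | yes x~y = yes (half-half x~y)
  ... | no x≁y  = no λ { (half-half x~y) → x≁y x~y }

  Adj-sym : ∀ {x y} → Adj x y → Adj y x
  Adj-sym (clq-clq a≢b)   = clq-clq (λ b≡a → a≢b (sym b≡a))
  Adj-sym clq-half        = half-clq
  Adj-sym half-clq        = clq-half
  Adj-sym (half-half x~y) = half-half (HAdj-sym x~y)

  Adj-irrefl : ∀ {x} → ¬ Adj x x
  Adj-irrefl (clq-clq a≢a)   = a≢a refl
  Adj-irrefl (half-half x~x) = HAdj-irrefl x~x

  -- numbering the vertices: clique first, then apex, L's and R's, so that
  -- H_t has 1 + (t + 1) + (t + 2) vertices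
  #half : ℕ
  #half = suc (suc t + suc (suc t))

  N : ℕ
  N = m + #half

  toHalf : Fin #half → Half t
  toHalf zero    = apex
  toHalf (suc u) = [ L , R ]′ (splitAt (suc t) u)

  fromHalf : Half t → Fin #half
  fromHalf apex  = zero
  fromHalf (L i) = suc (join (suc t) (suc (suc t)) (inj₁ i))
  fromHalf (R j) = suc (join (suc t) (suc (suc t)) (inj₂ j))

  toHalf-fromHalf : ∀ x → toHalf (fromHalf x) ≡ x
  toHalf-fromHalf apex  = refl
  toHalf-fromHalf (L i) = cong [ L , R ]′ (splitAt-join (suc t) (suc (suc t)) (inj₁ i))
  toHalf-fromHalf (R j) = cong [ L , R ]′ (splitAt-join (suc t) (suc (suc t)) (inj₂ j))

  fromHalf-toHalf : ∀ u → fromHalf (toHalf u) ≡ u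
  fromHalf-toHalf zero    = refl
  fromHalf-toHalf (suc u) = trans (from-LR (splitAt (suc t) u)) (cong suc (join-splitAt (suc t) (suc (suc t)) u))
    where
    from-LR : ∀ s → fromHalf ([ L , R ]′ s) ≡ suc (join (suc t) (suc (suc t)) s)
    from-LR (inj₁ _) = refl
    from-LR (inj₂ _) = refl

  split-vertex : Fin m ⊎ Fin #half → Vertex
  split-vertex = [ clq , (λ h → half (toHalf h)) ]′

  toV : Fin N → Vertex
  toV u = split-vertex (splitAt m u)

  fromV : Vertex → Fin N
  fromV (clq a)  = join m #half (inj₁ a)
  fromV (half x) = join m #half (inj₂ (fromHalf x))

  toV-fromV : ∀ x → toV (fromV x) ≡ x
  toV-fromV (clq a)  = cong split-vertex (splitAt-join m #half (inj₁ a))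
  toV-fromV (half x) = trans (cong split-vertex (splitAt-join m #half (inj₂ (fromHalf x))))
                             (cong half (toHalf-fromHalf x))

  fromV-toV : ∀ u → fromV (toV u) ≡ u
  fromV-toV u = trans (from-split (splitAt m u)) (join-splitAt m #half u)
    where
    from-split : ∀ s → fromV (split-vertex s) ≡ join m #half s
    from-split (inj₁ _) = refl
    from-split (inj₂ h) = cong (λ h' → join m #half (inj₂ h')) (fromHalf-toHalf h)

  open Presented toV fromV toV-fromV fromV-toV Adj Adj? Adj-sym Adj-irrefl public

  -- every vertex reaches the apex within two steps
  connected : Connected G
  connected = connected-via-hub G hub λ u → subst (λ w → Reachable G w hub) (fromV-toV u) (to-apex (toV u))
    where
    hub : Fin N
    hub = fromV (half apex)
    to-apex : ∀ x → Reachable G (fromV x) hub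
    to-apex (clq a)            = step-from clq-half here
    to-apex (half apex)        = here
    to-apex (half (L zero))    = step-from (half-half L₀-apex) here
    to-apex (half (L (suc i))) = step-from (half-half (L-R z≤n)) (step-from (half-half R-apex) here)
    to-apex (half (R j))       = step-from (half-half R-apex) here

  col : Vertex → Fin (3 + m)
  col (clq a)            = suc (suc (suc a))
  col (half apex)        = zero
  col (half (L zero))    = suc (suc zero)
  col (half (L (suc _))) = zero
  col (half (R _))       = suc zero

  cl : Fin (3 + m) → Vertex
  cl zero                = half apex
  cl (suc zero)          = half (R zero)
  cl (suc (suc zero))    = half (L zero)
  cl (suc (suc (suc a))) = clq a

  col-cl : ∀ i → col (cl i) ≡ i
  col-cl zero                = refl
  col-cl (suc zero)          = refl
  col-cl (suc (suc zero))    = refl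
  col-cl (suc (suc (suc a))) = refl

  sees-cl : ∀ x i → toℕ i < toℕ (col x) → Adj x (cl i)
  sees-cl (clq a) zero _                 = clq-half
  sees-cl (clq a) (suc zero) _           = clq-half
  sees-cl (clq a) (suc (suc zero)) _     = clq-half
  sees-cl (clq a) (suc (suc (suc b))) (s≤s (s≤s (s≤s b<a))) = clq-clq λ { refl → <⇒≢ b<a refl }
  sees-cl (half (L zero)) zero _         = half-half L₀-apex
  sees-cl (half (L zero)) (suc zero) _   = half-half (L-R z≤n)
  sees-cl (half (L zero)) (suc (suc i)) (s≤s (s≤s ()))
  sees-cl (half (R _)) zero _            = half-half R-apex
  sees-cl (half (R _)) (suc i) (s≤s ())

  -- of two clique vertices, the one with the larger colour sees the other
  cl-clique : ∀ i j → i ≢ j → Adj (cl i) (cl j)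
  cl-clique i j i≢j with <-cmp (toℕ i) (toℕ j)
  ... | tri< i<j _ _ = Adj-sym (sees-cl (cl j) i (subst (λ c → toℕ i < toℕ c) (sym (col-cl j)) i<j))
  ... | tri≈ _ i≡j _ = ⊥-elim (i≢j (toℕ-injective i≡j))
  ... | tri> _ _ j<i = sees-cl (cl i) j (subst (λ c → toℕ j < toℕ c) (sym (col-cl i)) j<i)

  col-half≢col-clq : ∀ x a → col (half x) ≢ col (clq a)
  col-half≢col-clq apex        a ()
  col-half≢col-clq (L zero)    a ()
  col-half≢col-clq (L (suc _)) a ()
  col-half≢col-clq (R _)       a ()

  col-proper : ProperV col
  col-proper _ _ (clq-clq a≢b) refl = a≢b refl
  col-proper (clq a) (half x) clq-half e = col-half≢col-clq x a (sym e)
  col-proper (half x) (clq a) half-clq e = col-half≢col-clq x a e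
  col-proper _ _ (half-half (L-R {i = zero} _)) ()
  col-proper _ _ (half-half (L-R {i = suc _} _)) ()
  col-proper _ _ (half-half (R-L {i = zero} _)) ()
  col-proper _ _ (half-half (R-L {i = suc _} _)) ()
  col-proper _ _ (half-half apex-R) ()
  col-proper _ _ (half-half R-apex) ()
  col-proper _ _ (half-half apex-L₀) ()
  col-proper _ _ (half-half L₀-apex) ()

  col-grundy : GrundyV col
  col-grundy = col-proper , (λ i → cl i , col-cl i) , λ x i lt → cl i , sees-cl x i lt , col-cl i

  chromatic : ChromaticNumber G (3 + m)
  chromatic = (colour , proper-lift col col-proper) , λ k k<3+m (ψ , ψ-proper) →
    <⇒≱ k<3+m (clique-bound G (λ i → fromV (cl i)) (λ i j i≢j → Adj⇒E-from (cl-clique i j i≢j)) ψ ψ-proper)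
    where
    colour : Fin N → Fin (3 + m)
    colour u = col (toV u)

  -- Γ(G) ≤ m + 3. The colours of a Grundy colouring either occur on the
  -- clique (at most m of them) or only inside H_t; by the four-layer lemma
  -- at most three colours of the second kind exist.
  grundy-bound : ∀ k → Σ (Fin N → Fin k) (Grundy G) → k ≤ 3 + m
  grundy-bound k (ψ , ψ-grundy) =
    ≤-trans (count-outside-image κ) (subst (m + #missed ≤_) (+-comm m 3) (+-monoʳ-≤ m at-most-three))
    where
    c : Vertex → Fin k
    c x = ψ (fromV x)
    c-grundy : GrundyV c
    c-grundy = grundy-pull ψ ψ-grundy
    κ : Fin m → Fin k
    κ a = c (clq a)
    M : Enum k (Missed κ)
    M = missed-enum κ
    #missed : ℕ
    #missed = cnt M

    in-half : ∀ {x i} → Missed κ i → c x ≡ i → ∃[ y ] x ≡ half y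
    in-half {clq a}  missed ca≡i = ⊥-elim (missed a ca≡i)
    in-half {half y} _ _ = y , refl

    module _ (4≤#missed : 4 ≤ #missed) where
      ℓ : Fin 4 → Fin k
      ℓ i = enum M (inject≤ i 4≤#missed)

      ℓ-missed : ∀ i → Missed κ (ℓ i)
      ℓ-missed i = enumP M (inject≤ i 4≤#missed)

      ℓ-mono : ∀ {i j} → toℕ i < toℕ j → toℕ (ℓ i) < toℕ (ℓ j)
      ℓ-mono {i} {j} i<j =
        enum-mono M (subst₂ _<_ (sym (toℕ-inject≤ i 4≤#missed)) (sym (toℕ-inject≤ j 4≤#missed)) i<j)

      open FourLayers (λ x → c (half x)) (λ x~y → proj₁ c-grundy _ _ (half-half x~y)) ℓ

      layered : Layered
      layered x i j i<j cx≡ℓj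
        with proj₂ (proj₂ c-grundy) (half x) (ℓ i) (subst (λ d → toℕ (ℓ i) < toℕ d) (sym cx≡ℓj) (ℓ-mono i<j))
      ... | y , x~y , cy≡ℓi with in-half {y} (ℓ-missed i) cy≡ℓi
      ...   | y' , refl with x~y
      ...     | half-half x~y' = y' , x~y' , cy≡ℓi

      top-colour-unused : ⊥
      top-colour-unused with proj₁ (proj₂ c-grundy) (ℓ (suc (suc (suc zero))))
      ... | x , cx≡ℓ3 with in-half {x} (ℓ-missed _) cx≡ℓ3
      ...   | y , refl = no-fourth-layer layered y cx≡ℓ3

    at-most-three : #missed ≤ 3
    at-most-three with 4 ≤? #missed
    ... | yes 4≤ = ⊥-elim (top-colour-unused 4≤)
    ... | no 4≰  = s≤s⁻¹ (≰⇒> 4≰)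

  hcls : Half t → Fin (3 + t)
  hcls apex  = zero
  hcls (L i) = suc (suc i)
  hcls (R j) = suc j

  hcls-proper : ∀ {x y} → HAdj x y → hcls x ≢ hcls y
  hcls-proper (L-R j≤i) e = 1+n≰n (subst (λ j → toℕ j ≤ _) (sym (suc-injective e)) j≤i)
  hcls-proper (R-L j≤i) e = 1+n≰n (subst (λ j → toℕ j ≤ _) (suc-injective e) j≤i)
  hcls-proper apex-R  ()
  hcls-proper R-apex  ()
  hcls-proper apex-L₀ ()
  hcls-proper L₀-apex ()

  -- classes R_j and R_{i+1} with j < i + 1 meet in the edge R_j L_i
  hcls-edges : ∀ c c' → c ≢ c' → ∃[ x ] ∃[ y ] (HAdj x y × hcls x ≡ c × hcls y ≡ c')
  hcls-edges zero    zero     c≢c' = ⊥-elim (c≢c' refl)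
  hcls-edges zero    (suc j)  _    = apex , R j , apex-R , refl , refl
  hcls-edges (suc j) zero     _    = R j , apex , R-apex , refl , refl
  hcls-edges (suc j) (suc j') c≢c' with <-cmp (toℕ j) (toℕ j')
  ... | tri≈ _ j≡j' _ = ⊥-elim (c≢c' (cong suc (toℕ-injective j≡j')))
  hcls-edges (suc j) (suc (suc i)) _ | tri< (s≤s j≤i) _ _ = R j , L i , R-L j≤i , refl , refl
  hcls-edges (suc (suc i)) (suc j) _ | tri> _ _ (s≤s j≤i) = L i , R j , L-R j≤i , refl , refl

  split-cls : Vertex → Fin m ⊎ Fin (3 + t)
  split-cls (clq a)  = inj₁ a
  split-cls (half x) = inj₂ (hcls x)

  cls : Vertex → Fin (m + (3 + t))
  cls x = join m (3 + t) (split-cls x)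

  vertex-of : Fin m ⊎ Fin (3 + t) → Vertex
  vertex-of (inj₁ a)       = clq a
  vertex-of (inj₂ zero)    = half apex
  vertex-of (inj₂ (suc j)) = half (R j)

  split-cls-vertex-of : ∀ s → split-cls (vertex-of s) ≡ s
  split-cls-vertex-of (inj₁ a)       = refl
  split-cls-vertex-of (inj₂ zero)    = refl
  split-cls-vertex-of (inj₂ (suc j)) = refl

  split-cls-proper : ∀ {x y} → Adj x y → split-cls x ≢ split-cls y
  split-cls-proper (clq-clq a≢b) refl = a≢b refl
  split-cls-proper clq-half ()
  split-cls-proper half-clq ()
  split-cls-proper (half-half x~y) e = hcls-proper x~y (inj₂-injective e)

  -- any two colours meet in an edge: the clique sees everything, and inside
  -- H_t this is hcls-edges
  split-cls-edges : ∀ s s' → s ≢ s' → ∃[ x ] ∃[ y ] (Adj x y × split-cls x ≡ s × split-cls y ≡ s')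
  split-cls-edges (inj₁ a) (inj₁ b) s≢s' = clq a , clq b , clq-clq (λ a≡b → s≢s' (cong inj₁ a≡b)) , refl , refl
  split-cls-edges (inj₁ a) (inj₂ c) _ = clq a , vertex-of (inj₂ c) , clq-sees c , refl , split-cls-vertex-of (inj₂ c)
    where
    clq-sees : ∀ c → Adj (clq a) (vertex-of (inj₂ c))
    clq-sees zero    = clq-half
    clq-sees (suc _) = clq-half
  split-cls-edges (inj₂ c) (inj₁ a) s≢s' with split-cls-edges (inj₁ a) (inj₂ c) (λ e → s≢s' (sym e))
  ... | x , y , x~y , sx , sy = y , x , Adj-sym x~y , sy , sx
  split-cls-edges (inj₂ c) (inj₂ c') s≢s' with hcls-edges c c' (λ c≡c' → s≢s' (cong inj₂ c≡c'))
  ... | x , y , x~y , hx , hy = half x , half y , half-half x~y , cong inj₂ hx , cong inj₂ hy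

  join-inj : ∀ {s s'} → join m (3 + t) s ≡ join m (3 + t) s' → s ≡ s'
  join-inj {s} {s'} e = trans (sym (splitAt-join m (3 + t) s)) (trans (cong (splitAt m) e) (splitAt-join m (3 + t) s'))

  splitAt-inj : ∀ {i j : Fin (m + (3 + t))} → splitAt m i ≡ splitAt m j → i ≡ j
  splitAt-inj {i} {j} e = trans (sym (join-splitAt m (3 + t) i)) (trans (cong (join m (3 + t)) e) (join-splitAt m (3 + t) j))

  cls-splitAt : ∀ {x} i → split-cls x ≡ splitAt m i → cls x ≡ i
  cls-splitAt {x} i e = trans (cong (join m (3 + t)) e) (join-splitAt m (3 + t) i)

  cls-complete : CompleteV cls
  cls-complete = proper , onto , edges
    where
    proper : ProperV cls
    proper x y x~y e = split-cls-proper x~y (join-inj e)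
    onto : OntoV cls
    onto i = vertex-of (splitAt m i) , cls-splitAt i (split-cls-vertex-of (splitAt m i))
    edges : ∀ i j → i ≢ j → ∃[ x ] ∃[ y ] (Adj x y × cls x ≡ i × cls y ≡ j)
    edges i j i≢j with split-cls-edges (splitAt m i) (splitAt m j) (λ e → i≢j (splitAt-inj e))
    ... | x , y , x~y , sx , sy = x , y , x~y , cls-splitAt i sx , cls-splitAt j sy

module MinimumOrder where
  open OrderBound using (complete-colouring-order)
  open import Data.Nat using (ℕ; suc; _+_; _*_; _∸_; _≤_; _<_; z≤n; s≤s; _≤?_)
  open import Data.Nat.Properties
  open import Data.Nat.Tactic.RingSolver using (solve-∀)
  open import Data.Fin using (Fin)
  open import Data.Product using (Σ; _,_)
  open import Data.Empty using (⊥-elim)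
  open import Relation.Nullary using (yes; no)
  open import Relation.Binary.PropositionalEquality using (_≡_; refl; sym; trans; cong; subst; module ≡-Reasoning)

  half-bound : ∀ k h → k + k < suc (h + h) → k ≤ h
  half-bound k h lt with k ≤? h
  ... | yes k≤h = k≤h
  ... | no k≰h = ⊥-elim (<⇒≱ lt (≤-trans (n≤1+n _)
    (subst (_≤ k + k) (cong suc (+-suc h h)) (+-mono-≤ (≰⇒> k≰h) (≰⇒> k≰h)))))

  f+t≡h : ∀ m t → 3 + m + t ≡ m + (3 + t)
  f+t≡h = solve-∀

  order+f : ∀ m t → m + suc (suc t + suc (suc t)) + (3 + m) ≡ suc (m + (3 + t) + (m + (3 + t)))
  order+f = solve-∀

  order-formula : ∀ m t → 2 * (m + (3 + t)) ∸ (3 + m) + 1 ≡ m + suc (suc t + suc (suc t))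
  order-formula m t = begin
    2 * (m + (3 + t)) ∸ (3 + m) + 1           ≡⟨ cong (λ x → x ∸ (3 + m) + 1) (double m t) ⟩
    (3 + m) + (m + (3 + (t + t))) ∸ (3 + m) + 1 ≡⟨ cong (_+ 1) (m+n∸m≡n (3 + m) (m + (3 + (t + t)))) ⟩
    m + (3 + (t + t)) + 1                     ≡⟨ plus-one m t ⟩
    m + suc (suc t + suc (suc t))             ∎
    where
    open ≡-Reasoning
    double : ∀ m t → 2 * (m + (3 + t)) ≡ (3 + m) + (m + (3 + (t + t)))
    double = solve-∀
    plus-one : ∀ m t → m + (3 + (t + t)) + 1 ≡ m + suc (suc t + suc (suc t))
    plus-one = solve-∀

  minimum-order : ∀ m t → 1 ≤ t →
    IsMinOrder (3 + m) (3 + m) (m + (3 + t)) (m + suc (suc t + suc (suc t)))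
  minimum-order m t 1≤t = (G , connected , chromatic , Γ , ψ) , minimal
    where
    open JoinGraph m t
    f h : ℕ
    f = 3 + m
    h = m + (3 + t)
    f<h : f < h
    f<h = subst (f <_) (f+t≡h m t) (subst (_≤ f + t) (+-comm f 1) (+-monoʳ-≤ f 1≤t))
    Γ : GrundyNumber G f
    Γ = ((λ u → col (toV u)) , grundy-lift col col-grundy) , grundy-bound
    ψ : AchromaticNumber G h
    ψ = ((λ u → cls (toV u)) , complete-lift cls cls-complete) , upper
      where
      upper : ∀ k → Σ (Fin N → Fin k) (Complete G) → k ≤ h
      upper k (φ , φ-complete) with k ≤? f
      ... | yes k≤f = ≤-trans k≤f (<⇒≤ f<h)
      ... | no k≰f = half-bound k h (subst (k + k <_) (order+f m t)
                       (complete-colouring-order G f grundy-bound φ φ-complete (≰⇒> k≰f)))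
    minimal : ∀ n (G' : Graph n) → Realizes G' f f h → N ≤ n
    minimal n G' (_ , _ , (_ , Γ'≤f) , ((φ , φ-complete) , _)) =
      +-cancelʳ-≤ f N n (subst (_≤ n + f) (sym (order+f m t)) (complete-colouring-order G' f Γ'≤f φ φ-complete f<h))

open MinimumOrder using (minimum-order; order-formula; f+t≡h)

-- Write f = m + 3 and h = f + t with t ≥ 1, and rewrite minimum-order.
theorem2 : ∀ (f g h : ℕ) → 2 < f → f ≡ g → g < h → IsMinOrder f g h (2 * h ∸ f + 1)
theorem2 (suc (suc (suc m))) _ h (s≤s (s≤s (s≤s _))) refl f<h with m≤n⇒∃[o]m+o≡n f<h
... | o , refl = subst (λ h → IsMinOrder f f h (2 * h ∸ f + 1)) (trans (sym (f+t≡h m (suc o))) (+-suc f o))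
                   (subst (IsMinOrder f f (m + (3 + suc o))) (sym (order-formula m (suc o)))
                     (minimum-order m (suc o) (s≤s z≤n)))
  where
  f : ℕ
  f = 3 + m
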